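{- Let $n,N\ge3$ be integers and let $(\Delta_n^i)_{2\le i\le N}$ be any instruction set generator. Then the map $\phi_n:B_n\to A_n$ is well defined and is a bijection between $B_n$ and $A_n$.
   Context: $S_n$ is the symmetric group on $\{1,\dots,n\}$, with composition written $\sigma_1\sigma_2=\sigma_2\circ\sigma_1$. An instruction set is a subset $\Delta_n=\{f_2,\dots,f_n\}\subset S_n$ of $n-1$ permutations with $f_k(k)=1$ for each $k$. An instruction set generator is a family of functions $\Delta_n^i:S_n^{i-1}\to\mathcal{P}(S_n)$, $2\le i\le N$, each of whose values is an instruction set. Let $V(K_n)=\{v_1,\dots,v_n\}$. $A_n$ is the set of column vectors $(v_{i_1},\dots,v_{i_N})$ with entries in $V(K_n)$, $v_{i_1}=v_1$, $v_{i_2}=v_2$, and $v_{i_j}\ne v_{i_{j+1}}$ for all $j$. $B_n$ is the set of column vectors $(\sigma_1,\dots,\sigma_N)$ of permutations with $\sigma_1=\mathrm{id}$, $\sigma_2=f_2$ (the element of $\Delta_n^2(\mathrm{id})$ with $f_2(2)=1$), and $\sigma_i\in\Delta_n^i(\sigma_1,\dots,\sigma_{i-1})$ for $i\ge2$. Let $D_n$ be the set of $n$-tuples of pairwise distinct elements of $V(K_n)$, with $S_n$ acting by $\sigma\cdot(v_{s_1},\dots,v_{s_n})=(v_{s_{\sigma^{ -1}(1)}},\dots,v_{s_{\sigma^{ -1}(n)}})$. For $(\sigma_1,\dots,\sigma_N)\in B_n$ set $o_1=(v_1,\dots,v_n)$ and $o_j=\sigma_j\cdot o_{j-1}$ for $2\le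 j\le N$; then $\phi_n(\sigma_1,\dots,\sigma_N)$ is the column whose $j$-th entry is the first coordinate of $o_j$. -}

module Defs where

open import Data.Nat using (ℕ; zero; suc)
open import Data.Fin using (Fin; zero; suc)
open import Data.Fin.Permutation using (Permutation′; _⟨$⟩ʳ_; _⟨$⟩ˡ_)
import Data.Fin.Permutation as Perm
open import Data.List using (List; []; _∷_; _++_; [_]; length)
open import Data.List.Relation.Unary.Linked using (Linked)
open import Data.Product using (Σ; ∃; _×_)
open import Data.Unit using (⊤)
open import Data.Empty using (⊥)
open import Relation.Binary.PropositionalEquality using (_≡_; _≢_)

-- Throughout, n = suc (suc m) (so n ≥ 2 and the vertices v₁ , v₂ exist).
-- Vertex v_{i+1} of K_n is represented by  i : Fin n  (v₁ = zero, v₂ = suc zero).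
-- A permutation σ ∈ S_n is a  Permutation′ n ; σ(i) is  σ ⟨$⟩ʳ i ,
-- σ⁻¹(i) is  σ ⟨$⟩ˡ i .

-- An instruction set Δ_n = {f₂,…,f_n} ⊂ S_n with f_k(k) = 1.
-- f (k : Fin (suc m)) is f_{k+2}; vertex k+2 is  suc k : Fin n .
record InstrSet (m : ℕ) : Set where
  field
    f    : Fin (suc m) → Permutation′ (suc (suc m))
    f-ok : ∀ k → f k ⟨$⟩ʳ suc k ≡ zero

open InstrSet public

_∈I_ : ∀ {m} → Permutation′ (suc (suc m)) → InstrSet m → Set
σ ∈I Δ = ∃ λ k → σ ≡ f Δ k

-- An instruction set generator: Δ^i(σ₁,…,σ_{i-1}) is  Δ (σ₁ ∷ … ∷ σ_{i-1} ∷ []) .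
-- (The index i is the length of the argument plus one.)
Generator : ℕ → Set
Generator m = List (Permutation′ (suc (suc m))) → InstrSet m

ValidFrom : ∀ {m} → Generator m → List (Permutation′ (suc (suc m)))
          → List (Permutation′ (suc (suc m))) → Set
ValidFrom Δ prev []       = ⊤
ValidFrom Δ prev (σ ∷ σs) = (σ ∈I Δ prev) × ValidFrom Δ (prev ++ [ σ ]) σs

InB : ∀ {m} (N : ℕ) → Generator m → List (Permutation′ (suc (suc m))) → Set
InB N Δ []            = ⊥
InB N Δ (σ₁ ∷ [])     = ⊥
InB N Δ (σ₁ ∷ σ₂ ∷ σs) =
  length (σ₁ ∷ σ₂ ∷ σs) ≡ N ×
  σ₁ ≡ Perm.id ×
  σ₂ ≡ f (Δ [ Perm.id ]) zero ×
  ValidFrom Δ [ σ₁ ] (σ₂ ∷ σs)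

InA : ∀ {m} (N : ℕ) → List (Fin (suc (suc m))) → Set
InA N []             = ⊥
InA N (a ∷ [])       = ⊥
InA N (a ∷ b ∷ as) =
  length (a ∷ b ∷ as) ≡ N ×
  a ≡ zero ×
  b ≡ suc zero ×
  Linked _≢_ (a ∷ b ∷ as)

-- Ordered n-tuples of vertices (v_{s₁},…,v_{s_n}) as maps  i ↦ s_{i+1} .
Tuple : ℕ → Set
Tuple n = Fin n → Fin n

act : ∀ {n} → Permutation′ n → Tuple n → Tuple n
act σ o i = o (σ ⟨$⟩ˡ i)

phiFrom : ∀ {n} → Tuple (suc n) → List (Permutation′ (suc n)) → List (Fin (suc n))
phiFrom o []       = []
phiFrom o (σ ∷ σs) = act σ o zero ∷ phiFrom (act σ o) σs

-- φ_n(σ₁,…,σ_N): o₁ = (v₁,…,v_n), o_j = σ_j·o_{j-1}, entry j = first coordinate of o_j.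
phi : ∀ {n} → List (Permutation′ (suc n)) → List (Fin (suc n))
phi []       = []
phi (σ₁ ∷ σs) = zero ∷ phiFrom (λ i → i) σs

-- Every tuple o_j is a bijection of the vertex set, since o₁ is the identity and
-- o_j = o_{j-1} ∘ σ_j⁻¹.  For an instruction f_k the new first coordinate is
-- o_{j-1}(k), because f_k⁻¹(1) = k.  As k ranges over 2,…,n this hits exactly
-- the vertices different from the previous first coordinate o_{j-1}(1), each
-- once; so at every step the admissible instructions correspond bijectively to
-- the admissible next vertices of a walk in K_n.
module Submission where

open import Defs
open import Data.Nat using (ℕ; suc; _≤_)
open import Data.Fin using (Fin; zero; suc)
open import Data.Fin.Properties using (suc-injective)
open import Data.Fin.Permutation using (Permutation′; _⟨$⟩ʳ_; _⟨$⟩ˡ_)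
import Data.Fin.Permutation as Perm
open import Data.List using (List; []; _∷_; _++_; [_]; length)
open import Data.List.Properties using (∷-injectiveˡ; ∷-injectiveʳ)
open import Data.List.Relation.Unary.Linked using (Linked; [-]; _∷_)
open import Data.Product using (∃; _×_; _,_)
open import Data.Unit using (tt)
open import Data.Empty using (⊥-elim)
open import Relation.Binary.PropositionalEquality
  using (_≡_; _≢_; refl; sym; trans; cong; cong₂; subst; module ≡-Reasoning)

record Invertible {n : ℕ} (o : Tuple n) : Set where
  field
    inverse  : Tuple n
    inverseˡ : ∀ x → inverse (o x) ≡ x
    inverseʳ : ∀ y → o (inverse y) ≡ y

  injective : ∀ {x y} → o x ≡ o y → x ≡ y
  injective {x} {y} ox≡oy = begin
    x             ≡⟨ sym (inverseˡ x) ⟩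
    inverse (o x) ≡⟨ cong inverse ox≡oy ⟩
    inverse (o y) ≡⟨ inverseˡ y ⟩
    y             ∎
    where open ≡-Reasoning

open Invertible

id-invertible : ∀ {n} → Invertible {n} (λ i → i)
id-invertible = record { inverse = λ i → i ; inverseˡ = λ _ → refl ; inverseʳ = λ _ → refl }

act-invertible : ∀ {n} (σ : Permutation′ n) {o : Tuple n} → Invertible o → Invertible (act σ o)
act-invertible σ {o} inv = record
  { inverse  = λ y → σ ⟨$⟩ʳ inverse inv y
  ; inverseˡ = λ x → trans (cong (σ ⟨$⟩ʳ_) (inverseˡ inv (σ ⟨$⟩ˡ x))) (Perm.inverseʳ σ)
  ; inverseʳ = λ y → trans (cong o (Perm.inverseˡ σ)) (inverseʳ inv y)
  }

length-phiFrom : ∀ {n} (o : Tuple (suc n)) σs → length (phiFrom o σs) ≡ length σs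
length-phiFrom o []       = refl
length-phiFrom o (σ ∷ σs) = cong suc (length-phiFrom (act σ o) σs)

length-phi : ∀ {n} (σs : List (Permutation′ (suc n))) → length (phi σs) ≡ length σs
length-phi []       = refl
length-phi (σ ∷ σs) = cong suc (length-phiFrom (λ i → i) σs)

module _ {m : ℕ} (I : InstrSet m) where

  instr⁻¹-zero : ∀ k → f I k ⟨$⟩ˡ zero ≡ suc k
  instr⁻¹-zero k = trans (cong (f I k ⟨$⟩ˡ_) (sym (f-ok I k))) (Perm.inverseˡ (f I k))

  act-instr-head : ∀ k (o : Tuple (suc (suc m))) → act (f I k) o zero ≡ o (suc k)
  act-instr-head k o = cong o (instr⁻¹-zero k)

  instr-determined-by-head : ∀ {o σ k} → Invertible o → σ ∈I I →
                             act σ o zero ≡ o (suc k) → σ ≡ f I k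
  instr-determined-by-head {o} inv (j , refl) head≡ =
    cong (f I) (suc-injective (injective inv (trans (sym (act-instr-head j o)) head≡)))

  act-instr-reaches : ∀ {o a k} (inv : Invertible o) → inverse inv a ≡ suc k →
                      act (f I k) o zero ≡ a
  act-instr-reaches {o} {a} {k} inv o⁻¹a≡ =
    trans (act-instr-head k o) (trans (cong o (sym o⁻¹a≡)) (inverseʳ inv a))

  act-instr-head-≢ : ∀ {o σ} → Invertible o → σ ∈I I → act σ o zero ≢ o zero
  act-instr-head-≢ {o} inv (k , refl) head≡
    with injective inv (trans (sym (act-instr-head k o)) head≡)
  ... | ()

module _ {m : ℕ} (Δ : Generator m) where

  phiFrom-linked : ∀ {o} prev σs → Invertible o → ValidFrom Δ prev σs →
                   Linked _≢_ (o zero ∷ phiFrom o σs)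
  phiFrom-linked prev []       inv tt = [-]
  phiFrom-linked prev (σ ∷ σs) inv (σ∈ , valid) =
    (λ eq → act-instr-head-≢ (Δ prev) inv σ∈ (sym eq))
    ∷ phiFrom-linked (prev ++ [ σ ]) σs (act-invertible σ inv) valid

  phiFrom-injective : ∀ {o} prev σs σs′ → Invertible o →
                      ValidFrom Δ prev σs → ValidFrom Δ prev σs′ →
                      phiFrom o σs ≡ phiFrom o σs′ → σs ≡ σs′
  phiFrom-injective prev []       []         inv _ _ _ = refl
  phiFrom-injective {o} prev (σ ∷ σs) (σ′ ∷ σs′) inv (σ∈ , valid) ((k , refl) , valid′) eq
    with instr-determined-by-head (Δ prev) {k = k} inv σ∈
           (trans (∷-injectiveˡ eq) (act-instr-head (Δ prev) k o))
  ... | refl = cong (σ ∷_) (phiFrom-injective (prev ++ [ σ ]) σs σs′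
                              (act-invertible σ inv) valid valid′ (∷-injectiveʳ eq))

  phiFrom-surjective : ∀ {o} prev as → Invertible o → Linked _≢_ (o zero ∷ as) →
                       ∃ λ σs → ValidFrom Δ prev σs × phiFrom o σs ≡ as
  phiFrom-surjective prev []       inv _ = [] , tt , refl
  phiFrom-surjective {o} prev (a ∷ as) inv (a≢o₀ ∷ linked) with inverse inv a in o⁻¹a
  ... | zero  = ⊥-elim (a≢o₀ (trans (cong o (sym o⁻¹a)) (inverseʳ inv a)))
  ... | suc k
    with reaches ← act-instr-reaches (Δ prev) inv o⁻¹a
    with σs , valid , eq ← phiFrom-surjective (prev ++ [ f (Δ prev) k ]) as
                             (act-invertible (f (Δ prev) k) inv)
                             (subst (λ x → Linked _≢_ (x ∷ as)) (sym reaches) linked)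
    = f (Δ prev) k ∷ σs , ((k , refl) , valid) , cong₂ _∷_ reaches eq

theorem24 : (m N : ℕ) → 3 ≤ suc (suc m) → 3 ≤ N → (Δ : Generator m) →
    ((b : List (Permutation′ (suc (suc m)))) → InB N Δ b → InA N (phi b)) ×
    ((b b′ : List (Permutation′ (suc (suc m)))) → InB N Δ b → InB N Δ b′ →
      phi b ≡ phi b′ → b ≡ b′) ×
    ((a : List (Fin (suc (suc m)))) → InA N a →
      ∃ λ (b : List (Permutation′ (suc (suc m)))) → InB N Δ b × phi b ≡ a)
theorem24 m N _ _ Δ = well-defined , injective-phi , surjective-phi
  where
  I₂ : InstrSet m
  I₂ = Δ [ Perm.id ]

  well-defined : ∀ b → InB N Δ b → InA N (phi b)
  well-defined b@(_ ∷ σ₂ ∷ σs) (len , refl , refl , valid) =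
    trans (length-phi b) len , refl , act-instr-head I₂ zero (λ i → i) ,
    phiFrom-linked Δ [ Perm.id ] (σ₂ ∷ σs) id-invertible valid

  injective-phi : ∀ b b′ → InB N Δ b → InB N Δ b′ → phi b ≡ phi b′ → b ≡ b′
  injective-phi (_ ∷ σs@(_ ∷ _)) (_ ∷ σs′@(_ ∷ _))
                (_ , refl , _ , valid) (_ , refl , _ , valid′) eq =
    cong (Perm.id ∷_)
         (phiFrom-injective Δ [ Perm.id ] σs σs′ id-invertible valid valid′ (∷-injectiveʳ eq))

  surjective-phi : ∀ a → InA N a → ∃ λ b → InB N Δ b × phi b ≡ a
  surjective-phi a@(_ ∷ as@(_ ∷ _)) (len , refl , refl , linked)
    with σ ∷ σs , valid@(σ∈ , _) , eq ← phiFrom-surjective Δ [ Perm.id ] as id-invertible linked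
    = b , (length-b , refl , σ₂≡f₂ , valid) , phi-b≡a
    where
    b : List (Permutation′ (suc (suc m)))
    b = Perm.id ∷ σ ∷ σs
    phi-b≡a : phi b ≡ a
    phi-b≡a = cong (zero ∷_) eq
    length-b : length b ≡ N
    length-b = trans (sym (length-phi b)) (trans (cong length phi-b≡a) len)
    σ₂≡f₂ : σ ≡ f I₂ zero
    σ₂≡f₂ = instr-determined-by-head I₂ id-invertible σ∈ (∷-injectiveˡ eq)
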